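{- Let $G=(V,E)$ be a split graph with vertex set $V=K\cup I$, where $K$ is a clique and $I$ is an independent set, and let $(V,\mathcal{F})$ be the split graph vertex shelling antimatroid defined on $G$. Then a subset $F\subseteq V$ is feasible (i.e. $F\in\mathcal{F}$) if and only if $N(F)$ induces a clique in $G$.
   Context: All graphs are finite and simple. A split graph is a graph whose vertex set is partitioned into a clique $K$ and an independent set $I$ (either may be empty); the partition is considered given. For $S\subseteq V$, $N(S)$ denotes the set of vertices $w\in V\setminus S$ adjacent to at least one vertex of $S$. A vertex is simplicial in a graph if its neighbours induce a clique. The split graph vertex shelling antimatroid $(V,\mathcal{F})$ defined on $G$ is the set system in which $F\subseteq V$ is feasible iff there is an ordering $(f_1,\dots,f_{|F|})$ of the elements of $F$ such that for every $j$, $f_j$ is simplicial in the graph $G\setminus\{f_1,\dots,f_{j-1}\}$ (in particular $\varnothing\in\mathcal{F}$). The empty set counts as a clique. -}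

module Defs where

open import Data.Nat using (ℕ)
open import Data.Fin using (Fin)
open import Data.Bool using (Bool; true; false)
open import Data.List using (List; []; _∷_)
open import Data.Product using (Σ; _×_; ∃)
open import Data.Unit using (⊤)
open import Relation.Nullary using (¬_)
open import Relation.Binary.PropositionalEquality using (_≡_; _≢_)
open import Function.Bundles using (_⇔_)
import Data.List.Membership.Propositional as L

-- A finite simple graph on vertex set Fin n, with a given split partition:
-- inK v ≡ true means v ∈ K, inK v ≡ false means v ∈ I.
record SplitGraph (n : ℕ) : Set where
  field
    adj      : Fin n → Fin n → Bool
    adj-sym  : ∀ u v → adj u v ≡ adj v u
    adj-irr  : ∀ v → adj v v ≡ false
    inK      : Fin n → Bool
    K-clique : ∀ u v → inK u ≡ true → inK v ≡ true → u ≢ v → adj u v ≡ true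
    I-indep  : ∀ u v → inK u ≡ false → inK v ≡ false → adj u v ≡ false

VSet : ℕ → Set
VSet n = Fin n → Bool

module _ {n : ℕ} (G : SplitGraph n) where
  open SplitGraph G

  -- v is simplicial in G \ R (R = list of already removed vertices):
  -- v is a vertex of G \ R and its neighbours in G \ R induce a clique.
  SimplicialIn : List (Fin n) → Fin n → Set
  SimplicialIn R v =
    (¬ (v L.∈ R)) ×
    (∀ w w' → ¬ (w L.∈ R) → ¬ (w' L.∈ R) →
       adj v w ≡ true → adj v w' ≡ true → w ≢ w' → adj w w' ≡ true)

  ShellingFrom : List (Fin n) → List (Fin n) → Set
  ShellingFrom R []       = ⊤
  ShellingFrom R (f ∷ fs) = SimplicialIn R f × ShellingFrom (f ∷ R) fs

  Feasible : VSet n → Set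
  Feasible F = Σ (List (Fin n)) λ fs →
    ShellingFrom [] fs × (∀ x → (F x ≡ true) ⇔ (x L.∈ fs))

  InN : VSet n → Fin n → Set
  InN F w = (F w ≡ false) × ∃ λ u → (F u ≡ true) × (adj u w ≡ true)

  NeighbourhoodIsClique : VSet n → Set
  NeighbourhoodIsClique F =
    ∀ w w' → InN F w → InN F w' → w ≢ w' → adj w w' ≡ true

-- (⇒) Take a shelling sequence of F and two distinct w, w' ∈ N(F).  Since
-- w, w' ∉ F they are never removed, so any vertex of F adjacent to both
-- forces w ~ w' at the moment it is shelled.  Such a common F-neighbour
-- exists whenever w or w' lies in K; if both lie in I, their F-neighbours
-- u, u' lie in K, and whichever of u, u' is shelled first makes the other
-- one a common F-neighbour.
--
-- (⇐) Shell F in three phases: first F ∩ I (an I-vertex is always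
-- simplicial), then the vertices of F ∩ K without a neighbour in I \ F
-- (all their remaining neighbours lie in K), then the rest of F ∩ K.  For
-- the last phase we use that N(F) ∩ I has at most one element.  Since
-- simpliciality is hereditary, it suffices to check that each vertex of a
-- phase is simplicial once the earlier phases have been removed.

module Submission where

open import Defs
open import Data.Nat using (ℕ)
open import Data.Bool using (Bool; true; false)
import Data.Bool as Bool
open import Data.Fin using (Fin; _≟_)
open import Data.Fin.Properties using (any?)
open import Data.List using (List; []; _∷_; _++_; _ʳ++_; filter; allFin)
open import Data.List.Relation.Unary.Any using (here; there)
open import Data.List.Relation.Unary.Any.Properties using (reverseAcc⁺; reverseAcc⁻)
import Data.List.Relation.Unary.All as All
open import Data.List.Relation.Unary.AllPairs using ([]; _∷_)
open import Data.List.Relation.Unary.Unique.Propositional using (Unique)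
open import Data.List.Relation.Unary.Unique.Propositional.Properties using (allFin⁺; filter⁺)
open import Data.List.Membership.Propositional using (_∈_)
open import Data.List.Membership.Propositional.Properties using (∈-allFin; ∈-filter⁺; ∈-filter⁻; ∈-++⁺ˡ; ∈-++⁺ʳ; ∈-++⁻)
open import Data.Product using (∃; _×_; _,_; proj₁; proj₂)
open import Data.Sum using (_⊎_; inj₁; inj₂; [_,_]′)
open import Data.Empty using (⊥; ⊥-elim)
open import Data.Unit using (tt)
open import Function.Bundles using (_⇔_; mk⇔; Equivalence)
open import Relation.Nullary using (¬_; yes; no; ¬?; _×-dec_)
open import Level using (0ℓ)
open import Relation.Unary using (Pred; Decidable)
open import Relation.Binary.PropositionalEquality using (_≡_; _≢_; refl; sym; trans)

clash : ∀ {b : Bool} → b ≡ true → b ≡ false → ⊥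
clash refl ()

module Shelling {n : ℕ} (G : SplitGraph n) where
  open SplitGraph G

  V : Set
  V = Fin n

  neighbour-of-I-in-K : ∀ {u w} → adj u w ≡ true → inK w ≡ false → inK u ≡ true
  neighbour-of-I-in-K {u} {w} u~w w∈I with inK u in K-u
  ... | true  = refl
  ... | false = ⊥-elim (clash u~w (I-indep u w K-u w∈I))

  in-out-distinct : (F : VSet n) → ∀ {u w} → F u ≡ true → F w ≡ false → u ≢ w
  in-out-distinct F u∈F w∉F refl = clash u∈F w∉F

  simplicial-if-K-neighbours : ∀ {R v} → ¬ v ∈ R →
    (∀ {w} → ¬ w ∈ R → adj v w ≡ true → inK w ≡ true) → SimplicialIn G R v
  simplicial-if-K-neighbours v∉R inK-nbr =
    v∉R , λ w w' w∉R w'∉R v~w v~w' w≢w' →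
      K-clique w w' (inK-nbr w∉R v~w) (inK-nbr w'∉R v~w') w≢w'

  -- Every present I-vertex is simplicial: its neighbours form part of K.
  I-vertex-simplicial : ∀ {R v} → inK v ≡ false → ¬ v ∈ R → SimplicialIn G R v
  I-vertex-simplicial {v = v} v∈I v∉R = simplicial-if-K-neighbours v∉R
    λ {w} _ v~w → neighbour-of-I-in-K (trans (adj-sym w v) v~w) v∈I

  simplicial-after-removal : ∀ {R v x} → SimplicialIn G R v → v ≢ x →
    SimplicialIn G (x ∷ R) v
  simplicial-after-removal (v∉R , clique) v≢x =
    (λ { (here v≡x) → v≢x v≡x ; (there v∈R) → v∉R v∈R }) ,
    λ w w' w∉ w'∉ → clique w w' (λ m → w∉ (there m)) (λ m → w'∉ (there m))

  shelled-not-removed : ∀ {R fs z} → ShellingFrom G R fs → z ∈ fs → ¬ z ∈ R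
  shelled-not-removed ((z∉R , _) , _) (here refl) = z∉R
  shelled-not-removed (_ , sh) (there z∈fs) z∈R = shelled-not-removed sh z∈fs (there z∈R)

  shelling-of-simplicials : ∀ {R xs} → Unique xs →
    (∀ {v} → v ∈ xs → SimplicialIn G R v) → ShellingFrom G R xs
  shelling-of-simplicials [] _ = tt
  shelling-of-simplicials (x≢xs ∷ unique) simplicial =
    simplicial (here refl) ,
    shelling-of-simplicials unique λ v∈xs →
      simplicial-after-removal (simplicial (there v∈xs))
        (λ v≡x → All.lookup x≢xs v∈xs (sym v≡x))

  shelling-++ : ∀ {R} xs {ys} → ShellingFrom G R xs →
    ShellingFrom G (xs ʳ++ R) ys → ShellingFrom G R (xs ++ ys)
  shelling-++ []       _          sh-ys = sh-ys
  shelling-++ (x ∷ xs) (sx , sh-xs) sh-ys = sx , shelling-++ xs sh-xs sh-ys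

  RemovedWithin : List V → List V → List V → Set
  RemovedWithin R' R xs = ∀ {z} → z ∈ R' → z ∈ R ⊎ z ∈ xs

  removed-within-step : ∀ {R' R f fs} → RemovedWithin R' (f ∷ R) fs →
    RemovedWithin R' R (f ∷ fs)
  removed-within-step within z∈R' with within z∈R'
  ... | inj₁ (here z≡f)  = inj₂ (here z≡f)
  ... | inj₁ (there z∈R) = inj₁ z∈R
  ... | inj₂ z∈fs        = inj₂ (there z∈fs)

  -- Of two shelled vertices u, u', one is shelled first, while the other is
  -- still present.  (For u = u' this just says u is simplicial at some stage.)
  first-shelled : ∀ {R fs u u'} → ShellingFrom G R fs → u ∈ fs → u' ∈ fs →
    ∃ λ R' → RemovedWithin R' R fs ×
      (SimplicialIn G R' u × ¬ u' ∈ R' ⊎ SimplicialIn G R' u' × ¬ u ∈ R')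
  first-shelled sh@(s , _) (here refl) u'∈fs =
    _ , inj₁ , inj₁ (s , shelled-not-removed sh u'∈fs)
  first-shelled sh@(s , _) (there u∈fs) (here refl) =
    _ , inj₁ , inj₂ (s , shelled-not-removed sh (there u∈fs))
  first-shelled (_ , sh) (there u∈fs) (there u'∈fs) with first-shelled sh u∈fs u'∈fs
  ... | R' , within , first = R' , removed-within-step within , first

  module Forward (F : VSet n) (fs : List V) (shelling : ShellingFrom G [] fs)
                 (F⇔fs : ∀ x → (F x ≡ true) ⇔ (x ∈ fs)) where

    in-fs : ∀ {x} → F x ≡ true → x ∈ fs
    in-fs {x} = Equivalence.to (F⇔fs x)

    outside-present : ∀ {R' z} → RemovedWithin R' [] fs → F z ≡ false → ¬ z ∈ R'
    outside-present within z∉F z∈R' with within z∈R'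
    ... | inj₂ z∈fs = clash (Equivalence.from (F⇔fs _) z∈fs) z∉F

    common-F-neighbour : ∀ {x w w'} → F x ≡ true → F w ≡ false → F w' ≡ false →
      adj x w ≡ true → adj x w' ≡ true → w ≢ w' → adj w w' ≡ true
    common-F-neighbour x∈F w∉F w'∉F x~w x~w' w≢w'
      with first-shelled shelling (in-fs x∈F) (in-fs x∈F)
    ... | R' , within , first = proj₂ ([ proj₁ , proj₁ ]′ first) _ _
            (outside-present within w∉F) (outside-present within w'∉F) x~w x~w' w≢w'

    earlier-neighbour : ∀ {R' u u' w} → RemovedWithin R' [] fs →
      SimplicialIn G R' u → ¬ u' ∈ R' →
      F u' ≡ true → inK u ≡ true → inK u' ≡ true → u ≢ u' →
      F w ≡ false → adj u w ≡ true → adj w u' ≡ true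
    earlier-neighbour {u = u} {u'} within (_ , clique) u'∉R' u'∈F u∈K u'∈K u≢u' w∉F u~w =
      clique _ u' (outside-present within w∉F) u'∉R' u~w (K-clique u u' u∈K u'∈K u≢u')
        (λ w≡u' → in-out-distinct F u'∈F w∉F (sym w≡u'))

    -- Two vertices w, w' ∉ F with F-neighbours u, u' ∈ K are adjacent: if
    -- u ≠ u', whichever of u, u' is shelled first makes the other one a
    -- common F-neighbour of w and w'.
    via-K-neighbours : ∀ {u u' w w'} → F u ≡ true → F u' ≡ true → inK u ≡ true →
      inK u' ≡ true → F w ≡ false → F w' ≡ false → adj u w ≡ true → adj u' w' ≡ true →
      w ≢ w' → adj w w' ≡ true
    via-K-neighbours {u} {u'} {w} {w'} u∈F u'∈F u∈K u'∈K w∉F w'∉F u~w u'~w' w≢w'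
      with u ≟ u'
    ... | yes refl = common-F-neighbour u∈F w∉F w'∉F u~w u'~w' w≢w'
    ... | no u≢u' with first-shelled shelling (in-fs u∈F) (in-fs u'∈F)
    ...   | R' , within , inj₁ (u-simplicial , u'∉R') =
      common-F-neighbour u'∈F w∉F w'∉F
        (trans (adj-sym u' w)
          (earlier-neighbour within u-simplicial u'∉R' u'∈F u∈K u'∈K u≢u' w∉F u~w))
        u'~w' w≢w'
    ...   | R' , within , inj₂ (u'-simplicial , u∉R') =
      common-F-neighbour u∈F w∉F w'∉F u~w
        (trans (adj-sym u w')
          (earlier-neighbour within u'-simplicial u∉R' u∈F u'∈K u∈K (λ u'≡u → u≢u' (sym u'≡u))
            w'∉F u'~w'))
        w≢w'

    neighbourhood-clique : NeighbourhoodIsClique G F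
    neighbourhood-clique w w' (w∉F , u , u∈F , u~w) (w'∉F , u' , u'∈F , u'~w') w≢w'
      with inK w in K-w | inK w' in K-w'
    ... | true  | true  = K-clique w w' K-w K-w' w≢w'
    ... | false | true  =
      common-F-neighbour u∈F w∉F w'∉F u~w
        (K-clique u w' (neighbour-of-I-in-K u~w K-w) K-w' (in-out-distinct F u∈F w'∉F)) w≢w'
    ... | true  | false =
      common-F-neighbour u'∈F w∉F w'∉F
        (K-clique u' w (neighbour-of-I-in-K u'~w' K-w') K-w (in-out-distinct F u'∈F w∉F))
        u'~w' w≢w'
    ... | false | false =
      via-K-neighbours u∈F u'∈F (neighbour-of-I-in-K u~w K-w) (neighbour-of-I-in-K u'~w' K-w')
        w∉F w'∉F u~w u'~w' w≢w'

  module Backward (F : VSet n) (N-clique : NeighbourhoodIsClique G F) where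

    N-I-unique : ∀ {i w} → InN G F i → InN G F w → inK i ≡ false → inK w ≡ false → i ≡ w
    N-I-unique {i} {w} i∈N w∈N i∈I w∈I with i ≟ w
    ... | yes i≡w = i≡w
    ... | no  i≢w = ⊥-elim (clash (N-clique i w i∈N w∈N i≢w) (I-indep i w i∈I w∈I))

    OutsideINeighbour : Pred V 0ℓ
    OutsideINeighbour v = ∃ λ i → inK i ≡ false × F i ≡ false × adj v i ≡ true

    outside-I-neighbour? : Decidable OutsideINeighbour
    outside-I-neighbour? v = any? λ i →
      inK i Bool.≟ false ×-dec F i Bool.≟ false ×-dec adj v i Bool.≟ true

    Phase₁ Phase₂ Phase₃ : Pred V 0ℓ
    Phase₁ v = F v ≡ true × inK v ≡ false
    Phase₂ v = F v ≡ true × inK v ≡ true × ¬ OutsideINeighbour v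
    Phase₃ v = F v ≡ true × OutsideINeighbour v

    phase-cover : ∀ {v} → F v ≡ true → Phase₁ v ⊎ Phase₂ v ⊎ Phase₃ v
    phase-cover {v} v∈F with inK v in K-v | outside-I-neighbour? v
    ... | false | _        = inj₁ (v∈F , refl)
    ... | true  | no  none = inj₂ (inj₁ (v∈F , refl , none))
    ... | true  | yes out  = inj₂ (inj₂ (v∈F , out))

    phase₃-in-K : ∀ {v} → Phase₃ v → inK v ≡ true
    phase₃-in-K (_ , _ , i∈I , _ , v~i) = neighbour-of-I-in-K v~i i∈I

    -- Stage 2: once F ∩ I is removed, a Phase₂ vertex has only K-neighbours left.
    phase₂-simplicial : ∀ {R v} → (∀ {z} → Phase₁ z → z ∈ R) → Phase₂ v → ¬ v ∈ R →
      SimplicialIn G R v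
    phase₂-simplicial {R} {v} F∩I-removed (_ , _ , none) v∉R =
      simplicial-if-K-neighbours v∉R K-neighbour
      where
      K-neighbour : ∀ {w} → ¬ w ∈ R → adj v w ≡ true → inK w ≡ true
      K-neighbour {w} w∉R v~w with inK w in K-w | F w in F-w
      ... | true  | _     = refl
      ... | false | false = ⊥-elim (none (w , K-w , F-w , v~w))
      ... | false | true  = ⊥-elim (w∉R (F∩I-removed (F-w , K-w)))

    Stage₃Invariant : List V → Set
    Stage₃Invariant R = ∀ {z} → ¬ z ∈ R → F z ≡ true → OutsideINeighbour z

    present-I-outside-F : ∀ {R w} → Stage₃Invariant R → ¬ w ∈ R → inK w ≡ false →
      F w ≡ false
    present-I-outside-F {w = w} invariant w∉R w∈I with F w in F-w
    ... | false = refl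
    ... | true with invariant w∉R F-w
    ...   | i , i∈I , _ , w~i = ⊥-elim (clash w~i (I-indep w i w∈I i∈I))

    -- Under the invariant, a present I-neighbour w of v ∈ F lies in N(F) and
    -- is adjacent to every other present neighbour w' of v: either w' ∈ N(F),
    -- or w' ∈ F has a neighbour in N(F) ∩ I, which can only be w.
    I-neighbour-adjacent : ∀ {R v w w'} → Stage₃Invariant R → F v ≡ true →
      ¬ w ∈ R → ¬ w' ∈ R → adj v w ≡ true → adj v w' ≡ true → w ≢ w' →
      inK w ≡ false → adj w w' ≡ true
    I-neighbour-adjacent {v = v} {w} {w'} invariant v∈F w∉R w'∉R v~w v~w' w≢w' w∈I =
      adjacent (F w') refl
      where
      w∈N : InN G F w
      w∈N = present-I-outside-F invariant w∉R w∈I , v , v∈F , v~w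
      adjacent : ∀ b → F w' ≡ b → adj w w' ≡ true
      adjacent false w'∉F = N-clique w w' w∈N (w'∉F , v , v∈F , v~w') w≢w'
      adjacent true  w'∈F with invariant w'∉R w'∈F
      ... | i , i∈I , i∉F , w'~i with N-I-unique (i∉F , w' , w'∈F , w'~i) w∈N i∈I w∈I
      ...   | refl = trans (adj-sym i w') w'~i

    stage₃-simplicial : ∀ {R v} → Stage₃Invariant R → F v ≡ true → ¬ v ∈ R →
      SimplicialIn G R v
    stage₃-simplicial {R} {v} invariant v∈F v∉R = v∉R , clique
      where
      clique : ∀ w w' → ¬ w ∈ R → ¬ w' ∈ R → adj v w ≡ true → adj v w' ≡ true →
        w ≢ w' → adj w w' ≡ true
      clique w w' w∉R w'∉R v~w v~w' w≢w' with inK w in K-w | inK w' in K-w'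
      ... | true  | true  = K-clique w w' K-w K-w' w≢w'
      ... | false | _     = I-neighbour-adjacent invariant v∈F w∉R w'∉R v~w v~w' w≢w' K-w
      ... | true  | false = trans (adj-sym w w')
        (I-neighbour-adjacent invariant v∈F w'∉R w∉R v~w' v~w (λ w'≡w → w≢w' (sym w'≡w)) K-w')

    select : ∀ {P : Pred V 0ℓ} → Decidable P → List V
    select P? = filter P? (allFin n)

    ∈-select⁺ : ∀ {P : Pred V 0ℓ} (P? : Decidable P) {v} → P v → v ∈ select P?
    ∈-select⁺ P? {v} p = ∈-filter⁺ P? (∈-allFin v) p

    ∈-select⁻ : ∀ {P : Pred V 0ℓ} (P? : Decidable P) {v} → v ∈ select P? → P v
    ∈-select⁻ P? v∈ = proj₂ (∈-filter⁻ P? {xs = allFin n} v∈)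

    select-unique : ∀ {P : Pred V 0ℓ} (P? : Decidable P) → Unique (select P?)
    select-unique P? = filter⁺ P? (allFin⁺ n)

    phase₁? : Decidable Phase₁
    phase₁? v = F v Bool.≟ true ×-dec inK v Bool.≟ false

    phase₂? : Decidable Phase₂
    phase₂? v = F v Bool.≟ true ×-dec inK v Bool.≟ true ×-dec ¬? (outside-I-neighbour? v)

    phase₃? : Decidable Phase₃
    phase₃? v = F v Bool.≟ true ×-dec outside-I-neighbour? v

    -- The shelling order xs₁ ++ xs₂ ++ xs₃ and the removed sets R₂, R₃ at
    -- the start of the second and third phase.
    xs₁ xs₂ xs₃ R₂ R₃ : List V
    xs₁ = select phase₁?
    xs₂ = select phase₂?
    xs₃ = select phase₃?
    R₂  = xs₁ ʳ++ []
    R₃  = xs₂ ʳ++ R₂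

    removed₂⁺ : ∀ {z} → Phase₁ z → z ∈ R₂
    removed₂⁺ p = reverseAcc⁺ [] xs₁ (inj₂ (∈-select⁺ phase₁? p))

    removed₂⁻ : ∀ {z} → z ∈ R₂ → Phase₁ z
    removed₂⁻ z∈R₂ with reverseAcc⁻ [] xs₁ z∈R₂
    ... | inj₂ z∈xs₁ = ∈-select⁻ phase₁? z∈xs₁

    removed₃⁺ : ∀ {z} → Phase₁ z ⊎ Phase₂ z → z ∈ R₃
    removed₃⁺ (inj₁ p) = reverseAcc⁺ R₂ xs₂ (inj₁ (removed₂⁺ p))
    removed₃⁺ (inj₂ p) = reverseAcc⁺ R₂ xs₂ (inj₂ (∈-select⁺ phase₂? p))

    removed₃⁻ : ∀ {z} → z ∈ R₃ → Phase₁ z ⊎ Phase₂ z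
    removed₃⁻ z∈R₃ with reverseAcc⁻ R₂ xs₂ z∈R₃
    ... | inj₁ z∈R₂  = inj₁ (removed₂⁻ z∈R₂)
    ... | inj₂ z∈xs₂ = inj₂ (∈-select⁻ phase₂? z∈xs₂)

    stage₁ : ShellingFrom G [] xs₁
    stage₁ = shelling-of-simplicials (select-unique phase₁?) λ v∈xs₁ →
      I-vertex-simplicial (proj₂ (∈-select⁻ phase₁? v∈xs₁)) λ ()

    stage₂ : ShellingFrom G R₂ xs₂
    stage₂ = shelling-of-simplicials (select-unique phase₂?) λ v∈xs₂ →
      let p@(_ , v∈K , _) = ∈-select⁻ phase₂? v∈xs₂
      in phase₂-simplicial removed₂⁺ p λ v∈R₂ → clash v∈K (proj₂ (removed₂⁻ v∈R₂))

    invariant₃ : Stage₃Invariant R₃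
    invariant₃ z∉R₃ z∈F with phase-cover z∈F
    ... | inj₁ p₁        = ⊥-elim (z∉R₃ (removed₃⁺ (inj₁ p₁)))
    ... | inj₂ (inj₁ p₂) = ⊥-elim (z∉R₃ (removed₃⁺ (inj₂ p₂)))
    ... | inj₂ (inj₂ p₃) = proj₂ p₃

    phase₃-present : ∀ {v} → Phase₃ v → ¬ v ∈ R₃
    phase₃-present p v∈R₃ with removed₃⁻ v∈R₃
    ... | inj₁ (_ , v∈I)      = clash (phase₃-in-K p) v∈I
    ... | inj₂ (_ , _ , none) = none (proj₂ p)

    stage₃ : ShellingFrom G R₃ xs₃
    stage₃ = shelling-of-simplicials (select-unique phase₃?) λ v∈xs₃ →
      let p = ∈-select⁻ phase₃? v∈xs₃
      in stage₃-simplicial invariant₃ (proj₁ p) (phase₃-present p)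

    in-phases : ∀ {x} → F x ≡ true → x ∈ xs₁ ++ xs₂ ++ xs₃
    in-phases x∈F with phase-cover x∈F
    ... | inj₁ p        = ∈-++⁺ˡ (∈-select⁺ phase₁? p)
    ... | inj₂ (inj₁ p) = ∈-++⁺ʳ xs₁ (∈-++⁺ˡ (∈-select⁺ phase₂? p))
    ... | inj₂ (inj₂ p) = ∈-++⁺ʳ xs₁ (∈-++⁺ʳ xs₂ (∈-select⁺ phase₃? p))

    phases-in-F : ∀ {x} → x ∈ xs₁ ++ xs₂ ++ xs₃ → F x ≡ true
    phases-in-F x∈ with ∈-++⁻ xs₁ x∈
    ... | inj₁ x∈xs₁ = proj₁ (∈-select⁻ phase₁? x∈xs₁)
    ... | inj₂ x∈ʳ with ∈-++⁻ xs₂ x∈ʳ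
    ...   | inj₁ x∈xs₂ = proj₁ (∈-select⁻ phase₂? x∈xs₂)
    ...   | inj₂ x∈xs₃ = proj₁ (∈-select⁻ phase₃? x∈xs₃)

    feasible : Feasible G F
    feasible = xs₁ ++ xs₂ ++ xs₃ ,
               shelling-++ xs₁ stage₁ (shelling-++ xs₂ stage₂ stage₃) ,
               λ x → mk⇔ in-phases phases-in-F

open Shelling

mainTheorem1 : ∀ {n : ℕ} (G : SplitGraph n) (F : VSet n) →
    Feasible G F ⇔ NeighbourhoodIsClique G F
mainTheorem1 G F = mk⇔
  (λ { (fs , shelling , F⇔fs) → Forward.neighbourhood-clique G F fs shelling F⇔fs })
  (Backward.feasible G F)
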